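{- Let $T$ be a tree with vertex set $\{1,\ldots,n\}$ and nonzero real edge weights, with no vertex of degree $2$. Let $\beta=\hat\delta'\hat\tau\hat\delta$ and $\eta=2\tau-L\hat\tau\hat\delta$. If $\beta\neq0$, then the squared distance matrix $\Delta$ of $T$ is nonsingular and $$\Delta^{ -1}=-\frac14 L\hat\tau L+\frac{1}{4\beta}\eta\eta'.$$
   Context: For vertices $i\neq j$, $d(i,j)$ is the sum of the weights of the edges on the unique $ij$-path, $d(i,i)=0$, and $\Delta$ is the $n\times n$ matrix with $(i,j)$-entry $d(i,j)^2$. $L$ is the weighted Laplacian: for $i\neq j$ its $(i,j)$-entry is $-1/w$ if $i,j$ are joined by an edge of weight $w$ and $0$ otherwise, with diagonal entries making all row sums zero. $\tau=(\tau_1,\ldots,\tau_n)'$ with $\tau_i=2-\delta_i$, $\delta_i$ the degree of vertex $i$; $\hat\tau=\mathrm{diag}(1/\tau_1,\ldots,1/\tau_n)$; $\hat\delta=(\hat\delta_1,\ldots,\hat\delta_n)'$ where $\hat\delta_i$ is the sum of the weights of the edges incident to $i$. A prime denotes transpose. -}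

module Defs where

open import Level using (Level; _⊔_)
open import Algebra.Bundles using (CommutativeRing)
open import Data.Nat as ℕ using (ℕ)
open import Data.Fin using (Fin; zero; suc; _≟_)
open import Data.Bool using (Bool; true; false; if_then_else_)
open import Data.List using (List; []; _∷_)
open import Data.List.Relation.Unary.Unique.Propositional using (Unique)
open import Data.Product using (Σ; _×_; proj₁)
open import Relation.Nullary using (¬_; does)
open import Relation.Binary.PropositionalEquality using (_≡_)

-- A field: a commutative ring with 1 ≠ 0 and a (total) inverse map that
-- is a genuine multiplicative inverse on every nonzero element.
-- (The value of 0 ⁻¹ is irrelevant and never used below.)

record Field (c ℓ : Level) : Set (Level.suc (c ⊔ ℓ)) where
  field
    commutativeRing : CommutativeRing c ℓ
  open CommutativeRing commutativeRing public
  field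
    _⁻¹       : Carrier → Carrier
    ⁻¹-cong   : ∀ {x y} → x ≈ y → x ⁻¹ ≈ y ⁻¹
    1≉0       : ¬ (1# ≈ 0#)
    inverseʳ  : ∀ x → ¬ (x ≈ 0#) → x * (x ⁻¹) ≈ 1#

module FieldDefs {c ℓ : Level} (F : Field c ℓ) where
  open Field F hiding (zero)

  ι : ℕ → Carrier
  ι ℕ.zero    = 0#
  ι (ℕ.suc m) = 1# + ι m

  CharZero : Set ℓ
  CharZero = ∀ m → ¬ (ι (ℕ.suc m) ≈ 0#)

  ∑ : ∀ {n} → (Fin n → Carrier) → Carrier
  ∑ {ℕ.zero}  f = 0#
  ∑ {ℕ.suc n} f = f zero + ∑ (λ i → f (suc i))

  count : ∀ {n} → (Fin n → Bool) → ℕ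
  count {ℕ.zero}  p = ℕ.zero
  count {ℕ.suc n} p = (if p zero then 1 else 0) ℕ.+ count (λ i → p (suc i))

  Matrix : ℕ → Set c
  Matrix n = Fin n → Fin n → Carrier

  Vector : ℕ → Set c
  Vector n = Fin n → Carrier

  _⊗_ : ∀ {n} → Matrix n → Matrix n → Matrix n
  (M ⊗ N) i j = ∑ (λ k → M i k * N k j)

  idMat : ∀ {n} → Matrix n
  idMat i j = if does (i ≟ j) then 1# else 0#

  _≈ᴹ_ : ∀ {n} → Matrix n → Matrix n → Set ℓ
  M ≈ᴹ N = ∀ i j → M i j ≈ N i j

  data Walk {n} (A : Fin n → Fin n → Bool) : Fin n → Fin n → Set where
    stop : ∀ {i} → Walk A i i
    step : ∀ {i j k} → A i j ≡ true → Walk A j k → Walk A i k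

  vertices : ∀ {n} {A : Fin n → Fin n → Bool} {i j} → Walk A i j → List (Fin n)
  vertices {i = i} stop       = i ∷ []
  vertices {i = i} (step _ p) = i ∷ vertices p

  walkWeight : ∀ {n} {A : Fin n → Fin n → Bool} (w : Fin n → Fin n → Carrier)
               {i j} → Walk A i j → Carrier
  walkWeight w stop                 = 0#
  walkWeight w (step {i} {j} _ p)   = w i j + walkWeight w p

  Path : ∀ {n} (A : Fin n → Fin n → Bool) → Fin n → Fin n → Set
  Path A i j = Σ (Walk A i j) (λ p → Unique (vertices p))

  record WTree (n : ℕ) : Set (c ⊔ ℓ) where
    field
      adj        : Fin n → Fin n → Bool
      weight     : Fin n → Fin n → Carrier
      adj-sym    : ∀ i j → adj i j ≡ adj j i
      adj-irrefl : ∀ i → adj i i ≡ false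
      weight-sym : ∀ i j → weight i j ≡ weight j i
      weight≉0   : ∀ i j → adj i j ≡ true → ¬ (weight i j ≈ 0#)
      path       : ∀ i j → Path adj i j
      path-unique : ∀ i j (p q : Path adj i j) →
                    vertices (proj₁ p) ≡ vertices (proj₁ q)

  module TreeDefs {n : ℕ} (T : WTree n) where
    open WTree T

    d : Fin n → Fin n → Carrier
    d i j = walkWeight weight (proj₁ (path i j))

    Δ : Matrix n
    Δ i j = d i j * d i j

    deg : Fin n → ℕ
    deg i = count (adj i)

    L : Matrix n
    L i j = if does (i ≟ j)
              then ∑ (λ k → if adj i k then weight i k ⁻¹ else 0#)
              else (if adj i j then - (weight i j ⁻¹) else 0#)

    two four : Carrier
    two  = ι 2
    four = ι 4

    τ : Vector n
    τ i = two - ι (deg i)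

    τ̂ : Matrix n
    τ̂ i j = if does (i ≟ j) then τ i ⁻¹ else 0#

    δ̂ : Vector n
    δ̂ i = ∑ (λ k → if adj i k then weight i k else 0#)

    β : Carrier
    β = ∑ (λ i → ∑ (λ j → δ̂ i * (τ̂ i j * δ̂ j)))

    η : Vector n
    η i = two * τ i - ∑ (λ k → (L ⊗ τ̂) i k * δ̂ k)

    ΔinvFormula : Matrix n
    ΔinvFormula i j = - (four ⁻¹) * ((L ⊗ τ̂) ⊗ L) i j
                      + (four * β) ⁻¹ * (η i * η j)

-- Seen from a vertex i, a tree looks as follows: for j ≠ i exactly one neighbour of i lies on
-- the path to j and is closer to j by its edge weight, while every other neighbour is farther by
-- its edge weight.  Since (L x)_i = Σ_{k ~ i} (x_i − x_k) / w_ik, this gives L D = τ 1' − 2 I and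
-- L Δ = 2 diag(τ) D − δ̂ 1', where D is the distance matrix.  As D, L and Δ are symmetric, the
-- two bracketings of D L Δ give τ'Δ = δ̂'D, and from these (L τ̂ L) Δ = η 1' − 4 I and η'Δ = β 1'.
-- Then (−¼ L τ̂ L + ηη'/(4β)) Δ = I is a direct computation, and Δ times it is I by symmetry.
-- The hypothesis on degrees is used only to make every τ_i invertible.

module Submission where

open import Defs
open import Level using (Level; _⊔_)
open import Algebra.Bundles using (CommutativeRing)
import Algebra.Solver.Ring as RingSolver
open import Algebra.Solver.Ring.AlmostCommutativeRing using (fromCommutativeRing; _-Raw-AlmostCommutative⟶_)
open import Data.Bool using (Bool; true; false; if_then_else_)
open import Data.Empty using (⊥-elim)
open import Data.Fin using (Fin; zero; suc; _≟_)
open import Data.Integer as ℤ using (ℤ)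
import Data.Integer.Properties as ℤ
open import Data.List using (List; []; _∷_; _∷ʳ_; reverse)
import Data.List.Properties as List
open import Data.List.Membership.Propositional using (_∈_; _∉_)
open import Data.List.Relation.Binary.Permutation.Propositional using (↭-sym; ↭⇒↭ₛ)
open import Data.List.Relation.Binary.Permutation.Propositional.Properties using (↭-reverse)
import Data.List.Relation.Binary.Permutation.Setoid.Properties as PermutationProperties
open import Data.List.Relation.Binary.Subset.Propositional using (_⊆_)
open import Data.List.Relation.Unary.All using ([]; _∷_)
open import Data.List.Relation.Unary.All.Properties.Core using (¬Any⇒All¬; All¬⇒¬Any)
open import Data.List.Relation.Unary.AllPairs using ([]; _∷_)
open import Data.List.Relation.Unary.Any using (here; there)
open import Data.List.Relation.Unary.Unique.Propositional using (Unique)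
open import Data.Maybe using (Maybe; just; nothing)
open import Data.Nat as ℕ using (ℕ)
import Data.Nat.Properties as ℕ
open import Data.Product using (Σ-syntax; _×_; _,_; proj₁)
open import Relation.Binary.PropositionalEquality as ≡ using (_≡_; _≢_)
open import Relation.Nullary using (¬_; Dec; yes; no; does)

module IntegerCoefficientSolver {c ℓ : Level} (R : CommutativeRing c ℓ) where
  open CommutativeRing R
  open import Data.Integer using (+_; -[1+_]; _⊖_)
  open import Algebra.Properties.Ring ring
    using (-‿distribˡ-*; -‿distribʳ-*; -‿involutive; -0#≈0#; -‿+-comm)
  open import Algebra.Properties.Group +-group using (quasigroup)
  open import Algebra.Properties.Quasigroup quasigroup using (x≈z//y)
  open import Algebra.Properties.Semiring.Mult semiring using (×-homo-+; ×1-homo-*)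
    renaming (_×_ to _·_)
  open import Relation.Binary.Reasoning.Setoid setoid

  embed : ℤ → Carrier
  embed (+ n)    = n · 1#
  embed -[1+ n ] = - (ℕ.suc n · 1#)

  embed[m⊖n]+n≈m : ∀ m n → embed (m ⊖ n) + n · 1# ≈ m · 1#
  embed[m⊖n]+n≈m m ℕ.zero rewrite ℤ.⊖-≥ {m} {0} ℕ.z≤n = +-identityʳ _
  embed[m⊖n]+n≈m ℕ.zero (ℕ.suc n) rewrite ℤ.⊖-< {0} {ℕ.suc n} (ℕ.s≤s ℕ.z≤n) = -‿inverseˡ _
  embed[m⊖n]+n≈m (ℕ.suc m) (ℕ.suc n) rewrite ℤ.[1+m]⊖[1+n]≡m⊖n m n = begin
    embed (m ⊖ n) + (1# + n · 1#)  ≈⟨ +-assoc _ _ _ ⟨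
    embed (m ⊖ n) + 1# + n · 1#    ≈⟨ +-congʳ (+-comm _ _) ⟩
    1# + embed (m ⊖ n) + n · 1#    ≈⟨ +-assoc _ _ _ ⟩
    1# + (embed (m ⊖ n) + n · 1#)  ≈⟨ +-congˡ (embed[m⊖n]+n≈m m n) ⟩
    1# + m · 1#                    ∎

  embed-⊖ : ∀ m n → embed (m ⊖ n) ≈ m · 1# - n · 1#
  embed-⊖ m n = x≈z//y _ _ _ (embed[m⊖n]+n≈m m n)

  embed-neg : ∀ x → embed (ℤ.- x) ≈ - embed x
  embed-neg (+ ℕ.zero)  = sym -0#≈0#
  embed-neg (+ ℕ.suc n) = refl
  embed-neg -[1+ n ]    = sym (-‿involutive _)

  embed-+ : ∀ x y → embed (x ℤ.+ y) ≈ embed x + embed y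
  embed-+ (+ m)    (+ n)    = ×-homo-+ 1# m n
  embed-+ (+ m)    -[1+ n ] = embed-⊖ m (ℕ.suc n)
  embed-+ -[1+ m ] (+ n)    = trans (embed-⊖ n (ℕ.suc m)) (+-comm _ _)
  embed-+ -[1+ m ] -[1+ n ] = begin
    - (ℕ.suc (ℕ.suc (m ℕ.+ n)) · 1#)     ≡⟨ ≡.cong (λ k → - (k · 1#)) (ℕ.+-suc (ℕ.suc m) n) ⟨
    - ((ℕ.suc m ℕ.+ ℕ.suc n) · 1#)       ≈⟨ -‿cong (×-homo-+ 1# (ℕ.suc m) (ℕ.suc n)) ⟩
    - (ℕ.suc m · 1# + ℕ.suc n · 1#)      ≈⟨ -‿+-comm _ _ ⟨
    - (ℕ.suc m · 1#) + - (ℕ.suc n · 1#)  ∎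

  embed-* : ∀ x y → embed (x ℤ.* y) ≈ embed x * embed y
  embed-* (+ m) (+ n) rewrite ℤ.+◃n≡+n (m ℕ.* n) = ×1-homo-* m n
  embed-* (+ m) -[1+ n ] rewrite ℤ.-◃n≡-n (m ℕ.* ℕ.suc n) = begin
    embed (ℤ.- + (m ℕ.* ℕ.suc n))  ≈⟨ embed-neg (+ (m ℕ.* ℕ.suc n)) ⟩
    - ((m ℕ.* ℕ.suc n) · 1#)       ≈⟨ -‿cong (×1-homo-* m (ℕ.suc n)) ⟩
    - (m · 1# * ℕ.suc n · 1#)      ≈⟨ -‿distribʳ-* _ _ ⟩
    m · 1# * - (ℕ.suc n · 1#)      ∎
  embed-* -[1+ m ] (+ n) rewrite ℤ.-◃n≡-n (ℕ.suc m ℕ.* n) = begin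
    embed (ℤ.- + (ℕ.suc m ℕ.* n))  ≈⟨ embed-neg (+ (ℕ.suc m ℕ.* n)) ⟩
    - ((ℕ.suc m ℕ.* n) · 1#)       ≈⟨ -‿cong (×1-homo-* (ℕ.suc m) n) ⟩
    - (ℕ.suc m · 1# * n · 1#)      ≈⟨ -‿distribˡ-* _ _ ⟩
    - (ℕ.suc m · 1#) * n · 1#      ∎
  embed-* -[1+ m ] -[1+ n ] rewrite ℤ.+◃n≡+n (ℕ.suc m ℕ.* ℕ.suc n) = begin
    (ℕ.suc m ℕ.* ℕ.suc n) · 1#         ≈⟨ ×1-homo-* (ℕ.suc m) (ℕ.suc n) ⟩
    ℕ.suc m · 1# * ℕ.suc n · 1#        ≈⟨ -‿involutive _ ⟨
    - - (ℕ.suc m · 1# * ℕ.suc n · 1#)  ≈⟨ -‿cong (-‿distribʳ-* _ _) ⟩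
    - (ℕ.suc m · 1# * - (ℕ.suc n · 1#))  ≈⟨ -‿distribˡ-* _ _ ⟩
    - (ℕ.suc m · 1#) * - (ℕ.suc n · 1#)  ∎

  -- Unlike embed, ⟦_⟧ sends 1 and -1 to 1# and - 1# on the nose; and since n · 1# unfolds
  -- exactly like ι n, the solver constants # 2 and # 4 are definitionally two and four.
  ⟦_⟧ : ℤ → Carrier
  ⟦ + 1 ⟧      = 1#
  ⟦ -[1+ 0 ] ⟧ = - 1#
  ⟦ x ⟧        = embed x

  ⟦⟧≈embed : ∀ x → ⟦ x ⟧ ≈ embed x
  ⟦⟧≈embed (+ 0)               = refl
  ⟦⟧≈embed (+ 1)               = sym (+-identityʳ 1#)
  ⟦⟧≈embed (+ ℕ.suc (ℕ.suc n)) = refl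
  ⟦⟧≈embed -[1+ 0 ]            = -‿cong (sym (+-identityʳ 1#))
  ⟦⟧≈embed -[1+ ℕ.suc n ]      = refl

  homomorphism : CommutativeRing.rawRing ℤ.+-*-commutativeRing
                   -Raw-AlmostCommutative⟶ fromCommutativeRing R
  homomorphism = record
    { ⟦_⟧    = ⟦_⟧
    ; +-homo = λ x y → trans (⟦⟧≈embed (x ℤ.+ y))
                         (trans (embed-+ x y) (sym (+-cong (⟦⟧≈embed x) (⟦⟧≈embed y))))
    ; *-homo = λ x y → trans (⟦⟧≈embed (x ℤ.* y))
                         (trans (embed-* x y) (sym (*-cong (⟦⟧≈embed x) (⟦⟧≈embed y))))
    ; -‿homo = λ x → trans (⟦⟧≈embed (ℤ.- x)) (trans (embed-neg x) (sym (-‿cong (⟦⟧≈embed x))))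
    ; 0-homo = refl
    ; 1-homo = refl
    }

  ⟦⟧-≟ : ∀ x y → Maybe (⟦ x ⟧ ≈ ⟦ y ⟧)
  ⟦⟧-≟ x y with x ℤ.≟ y
  ... | yes ≡.refl = just refl
  ... | no _       = nothing

  open RingSolver _ _ homomorphism ⟦⟧-≟ public
    using (solve; Polynomial; _:+_; _:*_; _:-_; :-_; _:=_)
  open RingSolver _ _ homomorphism ⟦⟧-≟ using (con)

  #_ : ∀ {m} → ℕ → Polynomial m
  # k = con (+ k)

module Summation {c ℓ : Level} (F : Field c ℓ) where
  open Field F hiding (zero)
  open FieldDefs F
  import Algebra.Properties.Semiring.Sum semiring as Sum
  open import Relation.Binary.Reasoning.Setoid setoid

  ∑≡sum : ∀ {n} (f : Vector n) → ∑ f ≡ Sum.sum f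
  ∑≡sum {ℕ.zero}  f = ≡.refl
  ∑≡sum {ℕ.suc n} f = ≡.cong (f zero +_) (∑≡sum (λ i → f (suc i)))

  ∑-cong : ∀ {n} {f g : Vector n} → (∀ i → f i ≈ g i) → ∑ f ≈ ∑ g
  ∑-cong {f = f} {g} f≈g = begin
    ∑ f       ≡⟨ ∑≡sum f ⟩
    Sum.sum f ≈⟨ Sum.sum-cong-≋ f≈g ⟩
    Sum.sum g ≡⟨ ∑≡sum g ⟨
    ∑ g       ∎

  ∑-zero : ∀ n → ∑ {n} (λ _ → 0#) ≈ 0#
  ∑-zero n = trans (reflexive (∑≡sum {n} _)) (Sum.sum-replicate-zero n)

  ∑-distrib-+ : ∀ {n} (f g : Vector n) → ∑ (λ i → f i + g i) ≈ ∑ f + ∑ g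
  ∑-distrib-+ f g = begin
    ∑ (λ i → f i + g i)      ≡⟨ ∑≡sum (λ i → f i + g i) ⟩
    Sum.sum (λ i → f i + g i) ≈⟨ Sum.∑-distrib-+ f g ⟩
    Sum.sum f + Sum.sum g    ≡⟨ ≡.cong₂ _+_ (∑≡sum f) (∑≡sum g) ⟨
    ∑ f + ∑ g                ∎

  *-distribˡ-∑ : ∀ {n} x (f : Vector n) → x * ∑ f ≈ ∑ (λ i → x * f i)
  *-distribˡ-∑ x f = begin
    x * ∑ f                  ≡⟨ ≡.cong (x *_) (∑≡sum f) ⟩
    x * Sum.sum f            ≈⟨ Sum.*-distribˡ-sum x f ⟩
    Sum.sum (λ i → x * f i)  ≡⟨ ∑≡sum (λ i → x * f i) ⟨
    ∑ (λ i → x * f i)        ∎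

  *-distribʳ-∑ : ∀ {n} x (f : Vector n) → ∑ f * x ≈ ∑ (λ i → f i * x)
  *-distribʳ-∑ x f = begin
    ∑ f * x                  ≡⟨ ≡.cong (_* x) (∑≡sum f) ⟩
    Sum.sum f * x            ≈⟨ Sum.*-distribʳ-sum x f ⟩
    Sum.sum (λ i → f i * x)  ≡⟨ ∑≡sum (λ i → f i * x) ⟨
    ∑ (λ i → f i * x)        ∎

  ∑-comm : ∀ {m n} (f : Fin m → Fin n → Carrier) →
           ∑ (λ i → ∑ (λ j → f i j)) ≈ ∑ (λ j → ∑ (λ i → f i j))
  ∑-comm f = begin
    ∑ (λ i → ∑ (λ j → f i j))             ≈⟨ ∑-cong (λ i → reflexive (∑≡sum (f i))) ⟩
    ∑ (λ i → Sum.sum (f i))               ≡⟨ ∑≡sum (λ i → Sum.sum (f i)) ⟩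
    Sum.sum (λ i → Sum.sum (f i))         ≈⟨ Sum.∑-comm f ⟩
    Sum.sum (λ j → Sum.sum (λ i → f i j)) ≡⟨ ∑≡sum (λ j → Sum.sum (λ i → f i j)) ⟨
    ∑ (λ j → Sum.sum (λ i → f i j))       ≈⟨ ∑-cong (λ j → reflexive (∑≡sum (λ i → f i j))) ⟨
    ∑ (λ j → ∑ (λ i → f i j))             ∎

  -‿distrib-∑ : ∀ {n} (f : Vector n) → - ∑ f ≈ ∑ (λ i → - f i)
  -‿distrib-∑ f = begin
    - ∑ f                   ≈⟨ -1*x≈-x (∑ f) ⟨
    - 1# * ∑ f              ≈⟨ *-distribˡ-∑ (- 1#) f ⟩
    ∑ (λ i → - 1# * f i)    ≈⟨ ∑-cong (λ i → -1*x≈-x (f i)) ⟩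
    ∑ (λ i → - f i)         ∎
    where open import Algebra.Properties.Ring ring using (-1*x≈-x)

  ∑-distrib-- : ∀ {n} (f g : Vector n) → ∑ (λ i → f i - g i) ≈ ∑ f - ∑ g
  ∑-distrib-- f g =
    trans (∑-distrib-+ f (λ i → - g i)) (+-congˡ (sym (-‿distrib-∑ g)))

  ∑-selectˡ : ∀ {n} (i : Fin n) (f : Vector n) →
              ∑ (λ k → if does (k ≟ i) then f k else 0#) ≈ f i
  ∑-selectˡ {ℕ.suc n} zero    f = trans (+-congˡ (∑-zero n)) (+-identityʳ _)
  ∑-selectˡ {ℕ.suc n} (suc i) f = trans (+-identityˡ _) (∑-selectˡ i (λ k → f (suc k)))

  ∑-selectʳ : ∀ {n} (i : Fin n) (f : Vector n) →
              ∑ (λ k → if does (i ≟ k) then f k else 0#) ≈ f i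
  ∑-selectʳ {ℕ.suc n} zero    f = trans (+-congˡ (∑-zero n)) (+-identityʳ _)
  ∑-selectʳ {ℕ.suc n} (suc i) f = trans (+-identityˡ _) (∑-selectʳ i (λ k → f (suc k)))

  ∑-count : ∀ {n} (p : Fin n → Bool) x → ∑ (λ k → if p k then x else 0#) ≈ ι (count p) * x
  ∑-count {ℕ.zero}  p x = sym (zeroˡ x)
  ∑-count {ℕ.suc n} p x with p zero
  ... | true  = trans (+-cong (sym (*-identityˡ x)) (∑-count (λ k → p (suc k)) x))
                      (sym (distribʳ x 1# _))
  ... | false = trans (+-identityˡ _) (∑-count (λ k → p (suc k)) x)

module FieldProperties {c ℓ : Level} (F : Field c ℓ) where
  open Field F hiding (zero)
  open FieldDefs F
  open import Algebra.Properties.Group +-group using (quasigroup)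
  open import Algebra.Properties.Quasigroup quasigroup using (cancelˡ)
  open import Relation.Binary.Reasoning.Setoid setoid

  inverseˡ : ∀ x → ¬ x ≈ 0# → x ⁻¹ * x ≈ 1#
  inverseˡ x x≉0 = trans (*-comm _ _) (inverseʳ x x≉0)

  x≈v*y⇒v⁻¹*x≈y : ∀ {v x y} → ¬ v ≈ 0# → x ≈ v * y → v ⁻¹ * x ≈ y
  x≈v*y⇒v⁻¹*x≈y {v} {x} {y} v≉0 x≈vy = begin
    v ⁻¹ * x          ≈⟨ *-congˡ x≈vy ⟩
    v ⁻¹ * (v * y)    ≈⟨ *-assoc _ _ _ ⟨
    v ⁻¹ * v * y      ≈⟨ *-congʳ (inverseˡ v v≉0) ⟩
    1# * y            ≈⟨ *-identityˡ y ⟩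
    y                 ∎

  x*y≉0 : ∀ {x y} → ¬ x ≈ 0# → ¬ y ≈ 0# → ¬ x * y ≈ 0#
  x*y≉0 {x} {y} x≉0 y≉0 xy≈0 = y≉0 (begin
    y                 ≈⟨ x≈v*y⇒v⁻¹*x≈y x≉0 refl ⟨
    x ⁻¹ * (x * y)    ≈⟨ *-congˡ xy≈0 ⟩
    x ⁻¹ * 0#         ≈⟨ zeroʳ _ ⟩
    0#                ∎)

  [x*y]⁻¹*y≈x⁻¹ : ∀ {x y} → ¬ x ≈ 0# → ¬ y ≈ 0# → (x * y) ⁻¹ * y ≈ x ⁻¹
  [x*y]⁻¹*y≈x⁻¹ {x} {y} x≉0 y≉0 = x≈v*y⇒v⁻¹*x≈y (x*y≉0 x≉0 y≉0) (begin
    y                 ≈⟨ *-identityˡ y ⟨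
    1# * y            ≈⟨ *-congʳ (inverseʳ x x≉0) ⟨
    x * x ⁻¹ * y      ≈⟨ *-assoc _ _ _ ⟩
    x * (x ⁻¹ * y)    ≈⟨ *-congˡ (*-comm _ _) ⟩
    x * (y * x ⁻¹)    ≈⟨ *-assoc _ _ _ ⟨
    x * y * x ⁻¹      ∎)

  ι-injective : CharZero → ∀ m n → ι m ≈ ι n → m ≡ n
  ι-injective char0 ℕ.zero    ℕ.zero    _  = ≡.refl
  ι-injective char0 ℕ.zero    (ℕ.suc n) eq = ⊥-elim (char0 n (sym eq))
  ι-injective char0 (ℕ.suc m) ℕ.zero    eq = ⊥-elim (char0 m eq)
  ι-injective char0 (ℕ.suc m) (ℕ.suc n) eq =
    ≡.cong ℕ.suc (ι-injective char0 m n (cancelˡ 1# (ι m) (ι n) eq))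

module MatrixAlgebra {c ℓ : Level} (F : Field c ℓ) where
  open Field F hiding (zero)
  open FieldDefs F
  open Summation F
  open FieldProperties F
  open IntegerCoefficientSolver commutativeRing
  open import Relation.Binary.Reasoning.Setoid setoid

  diag : ∀ {n} → Vector n → Matrix n
  diag v i j = if does (i ≟ j) then v i else 0#

  Symmetric : ∀ {n} → Matrix n → Set ℓ
  Symmetric M = ∀ i j → M i j ≈ M j i

  ⊗-diagʳ : ∀ {n} (M : Matrix n) (v : Vector n) i j → (M ⊗ diag v) i j ≈ M i j * v j
  ⊗-diagʳ M v i j = trans (∑-cong (λ k → *-if (does (k ≟ j)) (M i k) (v k)))
                          (∑-selectˡ j (λ k → M i k * v k))
    where
    *-if : ∀ b x y → x * (if b then y else 0#) ≈ (if b then x * y else 0#)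
    *-if true  x y = refl
    *-if false x y = zeroʳ x

  diag-quadraticForm : ∀ {n} (u v w : Vector n) →
                       ∑ (λ i → ∑ (λ j → u i * (diag v i j * w j))) ≈ ∑ (λ i → u i * (v i * w i))
  diag-quadraticForm u v w = ∑-cong (λ i →
    trans (∑-cong (λ j → masked (does (i ≟ j)) (u i) (v i) (w j))) (∑-selectʳ i (λ j → u i * (v i * w j))))
    where
    masked : ∀ b x y z → x * ((if b then y else 0#) * z) ≈ (if b then x * (y * z) else 0#)
    masked true  x y z = refl
    masked false x y z = trans (*-congˡ (zeroˡ z)) (zeroʳ x)

  ∑-*-∑-assoc : ∀ {n} (u : Vector n) (A : Matrix n) (v : Vector n) →
                ∑ (λ k → ∑ (λ m → u m * A m k) * v k) ≈ ∑ (λ m → u m * ∑ (λ k → A m k * v k))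
  ∑-*-∑-assoc u A v = begin
    ∑ (λ k → ∑ (λ m → u m * A m k) * v k)
      ≈⟨ ∑-cong (λ k → *-distribʳ-∑ (v k) (λ m → u m * A m k)) ⟩
    ∑ (λ k → ∑ (λ m → u m * A m k * v k))
      ≈⟨ ∑-comm (λ k m → u m * A m k * v k) ⟩
    ∑ (λ m → ∑ (λ k → u m * A m k * v k))
      ≈⟨ ∑-cong (λ m → ∑-cong (λ k → *-assoc (u m) (A m k) (v k))) ⟩
    ∑ (λ m → ∑ (λ k → u m * (A m k * v k)))
      ≈⟨ ∑-cong (λ m → *-distribˡ-∑ (u m) (λ k → A m k * v k)) ⟨
    ∑ (λ m → u m * ∑ (λ k → A m k * v k)) ∎

  ⊗-assoc : ∀ {n} (A B C : Matrix n) i j → ((A ⊗ B) ⊗ C) i j ≈ (A ⊗ (B ⊗ C)) i j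
  ⊗-assoc A B C i j = ∑-*-∑-assoc (A i) B (λ k → C k j)

  ⊗-transpose : ∀ {n} {A B : Matrix n} → Symmetric A → Symmetric B →
                ∀ i j → (A ⊗ B) i j ≈ (B ⊗ A) j i
  ⊗-transpose A-sym B-sym i j =
    ∑-cong (λ k → trans (*-cong (A-sym i k) (B-sym k j)) (*-comm _ _))

  idMat-symmetric : ∀ {n} → Symmetric (idMat {n})
  idMat-symmetric i j with i ≟ j | j ≟ i
  ... | yes _   | yes _   = refl
  ... | no  _   | no  _   = refl
  ... | yes i≡j | no  j≢i = ⊥-elim (j≢i (≡.sym i≡j))
  ... | no  i≢j | yes j≡i = ⊥-elim (i≢j (≡.sym j≡i))

  leftInverse⇒rightInverse : ∀ {n} {A B : Matrix n} → Symmetric A → Symmetric B →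
                             (B ⊗ A) ≈ᴹ idMat → (A ⊗ B) ≈ᴹ idMat
  leftInverse⇒rightInverse A-sym B-sym BA≈I i j =
    trans (⊗-transpose A-sym B-sym i j) (trans (BA≈I j i) (idMat-symmetric j i))

  module RankOneUpdate {n} (Δ M : Matrix n) (η : Vector n) {a b : Carrier}
    (a≉0 : ¬ a ≈ 0#) (b≉0 : ¬ b ≈ 0#)
    (MΔ : ∀ i j → (M ⊗ Δ) i j ≈ η i - a * idMat i j)
    (ηΔ : ∀ j → ∑ (λ k → η k * Δ k j) ≈ b) where

    inverse : Matrix n
    inverse i j = - (a ⁻¹) * M i j + (a * b) ⁻¹ * (η i * η j)

    inverse-symmetric : Symmetric M → Symmetric inverse
    inverse-symmetric M-sym i j = +-cong (*-congˡ (M-sym i j)) (*-congˡ (*-comm (η i) (η j)))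

    inverse-leftInverse : (inverse ⊗ Δ) ≈ᴹ idMat
    inverse-leftInverse i j = begin
      ∑ (λ k → (- (a ⁻¹) * M i k + γ * (η i * η k)) * Δ k j)
        ≈⟨ ∑-cong (λ k → expand (a ⁻¹) (M i k) γ (η i) (η k) (Δ k j)) ⟩
      ∑ (λ k → - (a ⁻¹) * (M i k * Δ k j) + γ * η i * (η k * Δ k j))
        ≈⟨ ∑-distrib-+ (λ k → - (a ⁻¹) * (M i k * Δ k j)) (λ k → γ * η i * (η k * Δ k j)) ⟩
      ∑ (λ k → - (a ⁻¹) * (M i k * Δ k j)) + ∑ (λ k → γ * η i * (η k * Δ k j))
        ≈⟨ +-cong (*-distribˡ-∑ (- (a ⁻¹)) (λ k → M i k * Δ k j))
                  (*-distribˡ-∑ (γ * η i) (λ k → η k * Δ k j)) ⟨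
      - (a ⁻¹) * (M ⊗ Δ) i j + γ * η i * ∑ (λ k → η k * Δ k j)
        ≈⟨ +-cong (*-congˡ (MΔ i j)) (*-congˡ (ηΔ j)) ⟩
      - (a ⁻¹) * (η i - a * idMat i j) + γ * η i * b
        ≈⟨ solve 6 (λ a′ a e I c′ b′ → (:- a′) :* (e :- a :* I) :+ c′ :* e :* b′
                                        := (:- (a′ :* e)) :+ a′ :* a :* I :+ c′ :* b′ :* e)
                   refl (a ⁻¹) a (η i) (idMat i j) γ b ⟩
      - (a ⁻¹ * η i) + a ⁻¹ * a * idMat i j + γ * b * η i
        ≈⟨ +-cong (+-congˡ (*-congʳ (inverseˡ a a≉0))) (*-congʳ ([x*y]⁻¹*y≈x⁻¹ a≉0 b≉0)) ⟩
      - (a ⁻¹ * η i) + 1# * idMat i j + a ⁻¹ * η i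
        ≈⟨ solve 3 (λ a′ e I → (:- (a′ :* e)) :+ # 1 :* I :+ a′ :* e := I)
                   refl (a ⁻¹) (η i) (idMat i j) ⟩
      idMat i j ∎
      where
      γ : Carrier
      γ = (a * b) ⁻¹
      expand : ∀ p x q e y z → (- p * x + q * (e * y)) * z ≈ - p * (x * z) + q * e * (y * z)
      expand = solve 6 (λ p x q e y z → ((:- p) :* x :+ q :* (e :* y)) :* z
                                        := (:- p) :* (x :* z) :+ q :* e :* (y :* z)) refl

    inverse-rightInverse : Symmetric Δ → Symmetric M → (Δ ⊗ inverse) ≈ᴹ idMat
    inverse-rightInverse Δ-sym M-sym =
      leftInverse⇒rightInverse Δ-sym (inverse-symmetric M-sym) inverse-leftInverse

module TreeMetric {c ℓ : Level} (F : Field c ℓ) {n : ℕ} (T : FieldDefs.WTree F n) where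
  open Field F hiding (zero)
  open FieldDefs F
  open WTree T
  open TreeDefs T
  open MatrixAlgebra F using (Symmetric)
  open import Relation.Binary.Reasoning.Setoid setoid
    using (begin_; _∎; step-≈-⟩; step-≈-⟨; step-≡-⟩; step-≡-⟨)

  adj-sym′ : ∀ {i k} → adj i k ≡ true → adj k i ≡ true
  adj-sym′ {i} {k} e = ≡.trans (adj-sym k i) e

  adj⇒≢ : ∀ {i k} → adj i k ≡ true → i ≢ k
  adj⇒≢ {i} e ≡.refl with ≡.trans (≡.sym e) (adj-irrefl i)
  ... | ()

  verticesWeight : List (Fin n) → Carrier
  verticesWeight []            = 0#
  verticesWeight (_ ∷ [])      = 0#
  verticesWeight (x ∷ y ∷ xs)  = weight x y + verticesWeight (y ∷ xs)

  walkWeight≡verticesWeight : ∀ {i j} (p : Walk adj i j) →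
                              walkWeight weight p ≡ verticesWeight (vertices p)
  walkWeight≡verticesWeight stop                     = ≡.refl
  walkWeight≡verticesWeight (step e stop)            = ≡.refl
  walkWeight≡verticesWeight (step {i} {j} e (step e′ p)) =
    ≡.cong (weight i j +_) (walkWeight≡verticesWeight (step e′ p))

  d≡walkWeight : ∀ {i j} (p : Path adj i j) → d i j ≡ walkWeight weight (proj₁ p)
  d≡walkWeight {i} {j} p =
    ≡.trans (walkWeight≡verticesWeight (proj₁ (path i j)))
      (≡.trans (≡.cong verticesWeight (path-unique i j (path i j) p))
               (≡.sym (walkWeight≡verticesWeight (proj₁ p))))

  d-refl : ∀ i → d i i ≈ 0#
  d-refl i = reflexive (d≡walkWeight (stop , [] ∷ []))

  d-adjacent : ∀ {i k} → adj i k ≡ true → d i k ≈ weight i k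
  d-adjacent e = trans (reflexive (d≡walkWeight (step e stop , (adj⇒≢ e ∷ []) ∷ [] ∷ [])))
                       (+-identityʳ _)

  snoc : ∀ {i j k} → Walk adj i j → adj j k ≡ true → Walk adj i k
  snoc stop        e = step e stop
  snoc (step e′ p) e = step e′ (snoc p e)

  vertices-snoc : ∀ {i j k} (p : Walk adj i j) (e : adj j k ≡ true) →
                  vertices (snoc p e) ≡ vertices p ∷ʳ k
  vertices-snoc stop        e = ≡.refl
  vertices-snoc (step _ p)  e = ≡.cong (_ ∷_) (vertices-snoc p e)

  walkWeight-snoc : ∀ {i j k} (p : Walk adj i j) (e : adj j k ≡ true) →
                    walkWeight weight (snoc p e) ≈ walkWeight weight p + weight j k
  walkWeight-snoc stop        e = trans (+-identityʳ _) (sym (+-identityˡ _))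
  walkWeight-snoc (step e′ p) e = trans (+-congˡ (walkWeight-snoc p e)) (sym (+-assoc _ _ _))

  reverseWalk : ∀ {i j} → Walk adj i j → Walk adj j i
  reverseWalk stop       = stop
  reverseWalk (step e p) = snoc (reverseWalk p) (adj-sym′ e)

  vertices-reverseWalk : ∀ {i j} (p : Walk adj i j) → vertices (reverseWalk p) ≡ reverse (vertices p)
  vertices-reverseWalk stop               = ≡.refl
  vertices-reverseWalk {i} (step e p) =
    ≡.trans (vertices-snoc (reverseWalk p) (adj-sym′ e))
      (≡.trans (≡.cong (_∷ʳ i) (vertices-reverseWalk p))
               (≡.sym (List.unfold-reverse i (vertices p))))

  walkWeight-reverseWalk : ∀ {i j} (p : Walk adj i j) →
                           walkWeight weight (reverseWalk p) ≈ walkWeight weight p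
  walkWeight-reverseWalk stop = refl
  walkWeight-reverseWalk {i} (step {j = j} e p) = begin
    walkWeight weight (snoc (reverseWalk p) (adj-sym′ e))
      ≈⟨ walkWeight-snoc (reverseWalk p) (adj-sym′ e) ⟩
    walkWeight weight (reverseWalk p) + weight j i
      ≈⟨ +-cong (walkWeight-reverseWalk p) (reflexive (weight-sym j i)) ⟩
    walkWeight weight p + weight i j
      ≈⟨ +-comm _ _ ⟩
    weight i j + walkWeight weight p ∎

  reversePath : ∀ {i j} → Path adj i j → Path adj j i
  reversePath (p , p-unique) = reverseWalk p ,
    ≡.subst Unique (≡.sym (vertices-reverseWalk p))
      (AllPairs-resp-↭ ≡.≢-sym (≡.resp₂ _≢_) (↭⇒↭ₛ (↭-sym (↭-reverse (vertices p)))) p-unique)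
    where open PermutationProperties (≡.setoid (Fin n)) using (AllPairs-resp-↭)

  d-sym : ∀ i j → d i j ≈ d j i
  d-sym i j = begin
    d i j                                          ≡⟨ d≡walkWeight (path i j) ⟩
    walkWeight weight (proj₁ (path i j))           ≈⟨ walkWeight-reverseWalk (proj₁ (path i j)) ⟨
    walkWeight weight (proj₁ (reversePath (path i j))) ≡⟨ d≡walkWeight (reversePath (path i j)) ⟨
    d j i                                          ∎

  diagonal-farther : ∀ {i k} → adj i k ≡ true → d k i ≈ weight i k + d i i
  diagonal-farther {i} {k} e = begin
    d k i               ≈⟨ d-sym k i ⟩
    d i k               ≈⟨ d-adjacent e ⟩
    weight i k          ≈⟨ +-identityʳ _ ⟨
    weight i k + 0#     ≈⟨ +-congˡ (d-refl i) ⟨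
    weight i k + d i i  ∎

  Δ-symmetric : Symmetric Δ
  Δ-symmetric i j = *-cong (d-sym i j) (d-sym i j)

  prependEdge : ∀ {i k j} → adj i k ≡ true → (p : Path adj k j) → i ∉ vertices (proj₁ p) → Path adj i j
  prependEdge e (p , p-unique) i∉p = step e p , ¬Any⇒All¬ (vertices p) i∉p ∷ p-unique

  pathPrefix : ∀ {a b x} (p : Path adj a b) → x ∈ vertices (proj₁ p) →
           Σ[ q ∈ Path adj a x ] vertices (proj₁ q) ⊆ vertices (proj₁ p)
  pathPrefix (stop , _)     (here ≡.refl) = (stop , [] ∷ []) , λ { (here eq) → here eq }
  pathPrefix (step _ _ , _) (here ≡.refl) = (stop , [] ∷ []) , λ { (here eq) → here eq }
  pathPrefix (step e p , a∉p ∷ p-unique) (there x∈p) with pathPrefix (p , p-unique) x∈p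
  ... | q , q⊆p = prependEdge e q (λ a∈q → All¬⇒¬Any a∉p (q⊆p a∈q)) ,
                  λ { (here eq) → here eq ; (there y∈q) → there (q⊆p y∈q) }

  vertices-head : ∀ {a b x xs} (p : Walk adj a b) → vertices p ≡ x ∷ xs → a ≡ x
  vertices-head stop       eq = List.∷-injectiveˡ eq
  vertices-head (step _ _) eq = List.∷-injectiveˡ eq

  record Toward (i j : Fin n) : Set (c ⊔ ℓ) where
    field
      next           : Fin n
      next-adj       : adj i next ≡ true
      next-closer    : d i j ≈ weight i next + d next j
      others-farther : ∀ k → adj i k ≡ true → k ≢ next → d k j ≈ weight i k + d i j

  toward : ∀ {i j} → i ≢ j → Toward i j
  toward {i} {j} i≢j with path i j
  ... | stop , _ = ⊥-elim (i≢j ≡.refl)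
  ... | step {j = k₀} e p , i∉p ∷ p-unique = record
    { next           = k₀
    ; next-adj       = e
    ; next-closer    = closer
    ; others-farther = farther
    }
    where
    d≡ : d i j ≡ weight i k₀ + walkWeight weight p
    d≡ = d≡walkWeight (step e p , i∉p ∷ p-unique)

    closer : d i j ≈ weight i k₀ + d k₀ j
    closer = reflexive (≡.trans d≡ (≡.cong (weight i k₀ +_) (≡.sym (d≡walkWeight (p , p-unique)))))

    farther : ∀ k → adj i k ≡ true → k ≢ k₀ → d k j ≈ weight i k + d i j
    farther k ek k≢k₀ = begin
      d k j
        ≡⟨ d≡walkWeight (prependEdge (adj-sym′ ek) (step e p , i∉p ∷ p-unique) k∉) ⟩
      weight k i + (weight i k₀ + walkWeight weight p)
        ≡⟨ ≡.cong₂ _+_ (weight-sym k i) (≡.sym d≡) ⟩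
      weight i k + d i j ∎
      where
      k∉p : k ∉ vertices p
      -- otherwise i, k₀, …, k would be a second i–k path besides the edge i–k
      k∉p k∈p with pathPrefix (p , p-unique) k∈p
      ... | q , q⊆p = k≢k₀ (≡.sym (vertices-head (proj₁ q) (List.∷-injectiveʳ
              (path-unique i k (prependEdge e q (λ i∈q → All¬⇒¬Any i∉p (q⊆p i∈q)))
                               (step ek stop , (adj⇒≢ ek ∷ []) ∷ [] ∷ [])))))
      k∉ : k ∉ i ∷ vertices p
      k∉ (here k≡i)   = adj⇒≢ ek (≡.sym k≡i)
      k∉ (there k∈p)  = k∉p k∈p

module Laplacian {c ℓ : Level} (F : Field c ℓ) {n : ℕ} (T : FieldDefs.WTree F n) where
  open Field F hiding (zero)
  open FieldDefs F
  open WTree T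
  open TreeDefs T
  open Summation F
  open FieldProperties F
  open MatrixAlgebra F
  open TreeMetric F T
  open IntegerCoefficientSolver commutativeRing
  open import Relation.Binary.Reasoning.Setoid setoid
    using (begin_; _∎; step-≈-⟩; step-≈-⟨; step-≡-⟩; step-≡-⟨)

  neighbourSum : Fin n → Vector n → Carrier
  neighbourSum i f = ∑ (λ k → if adj i k then f k else 0#)

  neighbourSum-cong : ∀ i {f g : Vector n} → (∀ k → adj i k ≡ true → f k ≈ g k) →
                      neighbourSum i f ≈ neighbourSum i g
  neighbourSum-cong i {f} {g} f≈g = ∑-cong (λ k → masked k (adj i k) ≡.refl)
    where
    masked : ∀ k b → adj i k ≡ b → (if b then f k else 0#) ≈ (if b then g k else 0#)
    masked k true  e = f≈g k e
    masked k false _ = refl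

  neighbourSum-distrib-+ : ∀ i (f g : Vector n) →
                           neighbourSum i (λ k → f k + g k) ≈ neighbourSum i f + neighbourSum i g
  neighbourSum-distrib-+ i f g =
    trans (∑-cong (λ k → masked (adj i k) (f k) (g k)))
          (∑-distrib-+ (λ k → if adj i k then f k else 0#) (λ k → if adj i k then g k else 0#))
    where
    masked : ∀ b x y → (if b then x + y else 0#) ≈ (if b then x else 0#) + (if b then y else 0#)
    masked true  x y = refl
    masked false x y = sym (+-identityˡ 0#)

  *-distribʳ-neighbourSum : ∀ i (f : Vector n) x →
                            neighbourSum i f * x ≈ neighbourSum i (λ k → f k * x)
  *-distribʳ-neighbourSum i f x =
    trans (*-distribʳ-∑ x (λ k → if adj i k then f k else 0#)) (∑-cong (λ k → masked (adj i k) (f k)))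
    where
    masked : ∀ b y → (if b then y else 0#) * x ≈ (if b then y * x else 0#)
    masked true  y = refl
    masked false y = zeroˡ x

  neighbourSum-const : ∀ i x → neighbourSum i (λ _ → x) ≈ ι (deg i) * x
  neighbourSum-const i = ∑-count (adj i)

  neighbourSum-neg : ∀ i (f : Vector n) → neighbourSum i (λ k → - f k) ≈ - neighbourSum i f
  neighbourSum-neg i f =
    trans (∑-cong (λ k → masked (adj i k) (f k))) (sym (-‿distrib-∑ (λ k → if adj i k then f k else 0#)))
    where
    open import Algebra.Properties.Ring ring using (-0#≈0#)
    masked : ∀ b x → (if b then - x else 0#) ≈ - (if b then x else 0#)
    masked true  x = refl
    masked false x = sym -0#≈0#

  neighbourSum-bump : ∀ i {k₀} → adj i k₀ ≡ true → ∀ (f g : Vector n) x →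
                      (∀ k → adj i k ≡ true → f k ≈ g k + (if does (k ≟ k₀) then x else 0#)) →
                      neighbourSum i f ≈ neighbourSum i g + x
  neighbourSum-bump i {k₀} e₀ f g x f≈g+x = begin
    neighbourSum i f
      ≈⟨ ∑-cong (λ k → masked k (adj i k) ≡.refl) ⟩
    ∑ (λ k → (if adj i k then g k else 0#) + (if does (k ≟ k₀) then x else 0#))
      ≈⟨ ∑-distrib-+ (λ k → if adj i k then g k else 0#) (λ k → if does (k ≟ k₀) then x else 0#) ⟩
    neighbourSum i g + ∑ (λ k → if does (k ≟ k₀) then x else 0#)
      ≈⟨ +-congˡ (∑-selectˡ k₀ (λ _ → x)) ⟩
    neighbourSum i g + x ∎
    where
    masked : ∀ k b → adj i k ≡ b →
             (if b then f k else 0#) ≈ (if b then g k else 0#) + (if does (k ≟ k₀) then x else 0#)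
    masked k true  e = f≈g+x k e
    masked k false e with k ≟ k₀
    ... | no _       = sym (+-identityʳ 0#)
    ... | yes ≡.refl with () ← ≡.trans (≡.sym e₀) e

  L-apply : ∀ i (x : Vector n) →
            ∑ (λ k → L i k * x k) ≈ neighbourSum i (λ k → weight i k ⁻¹ * (x i - x k))
  L-apply i x = begin
    ∑ (λ k → L i k * x k)
      ≈⟨ ∑-cong (λ k → entry k (i ≟ k)) ⟩
    ∑ (λ k → (if does (i ≟ k) then S * x k else 0#) + off k)
      ≈⟨ ∑-distrib-+ (λ k → if does (i ≟ k) then S * x k else 0#) off ⟩
    ∑ (λ k → if does (i ≟ k) then S * x k else 0#) + neighbourSum i (λ k → - (weight i k ⁻¹) * x k)
      ≈⟨ +-congʳ (∑-selectʳ i (λ k → S * x k)) ⟩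
    S * x i + neighbourSum i (λ k → - (weight i k ⁻¹) * x k)
      ≈⟨ +-congʳ (*-distribʳ-neighbourSum i (λ k → weight i k ⁻¹) (x i)) ⟩
    neighbourSum i (λ k → weight i k ⁻¹ * x i) + neighbourSum i (λ k → - (weight i k ⁻¹) * x k)
      ≈⟨ neighbourSum-distrib-+ i (λ k → weight i k ⁻¹ * x i) (λ k → - (weight i k ⁻¹) * x k) ⟨
    neighbourSum i (λ k → weight i k ⁻¹ * x i + - (weight i k ⁻¹) * x k)
      ≈⟨ neighbourSum-cong i (λ k _ → factor (weight i k ⁻¹) (x i) (x k)) ⟩
    neighbourSum i (λ k → weight i k ⁻¹ * (x i - x k)) ∎
    where
    S : Carrier
    S = neighbourSum i (λ k → weight i k ⁻¹)

    off : Vector n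
    off k = if adj i k then - (weight i k ⁻¹) * x k else 0#

    entry : ∀ k (i≟k : Dec (i ≡ k)) →
            (if does i≟k then S else (if adj i k then - (weight i k ⁻¹) else 0#)) * x k
            ≈ (if does i≟k then S * x k else 0#) + off k
    entry k (yes ≡.refl) rewrite adj-irrefl i = sym (+-identityʳ _)
    entry k (no _) with adj i k
    ... | true  = sym (+-identityˡ _)
    ... | false = trans (zeroˡ (x k)) (sym (+-identityˡ 0#))

    factor : ∀ u y z → u * y + - u * z ≈ u * (y - z)
    factor = solve 3 (λ u y z → u :* y :+ (:- u) :* z := u :* (y :- z)) refl

  L-symmetric : Symmetric L
  L-symmetric i k with i ≟ k | k ≟ i
  ... | yes ≡.refl | yes _    = refl
  ... | yes ≡.refl | no  k≢i  = ⊥-elim (k≢i ≡.refl)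
  ... | no  i≢k    | yes k≡i  = ⊥-elim (i≢k (≡.sym k≡i))
  ... | no  _      | no  _    rewrite adj-sym i k | weight-sym i k = refl

  farther-difference : ∀ {w D E} → E ≈ w + D → D - E ≈ w * (- 1# + 0#)
  farther-difference {w} {D} {E} E≈w+D = trans (+-congˡ (-‿cong E≈w+D))
    (solve 2 (λ w D → D :- (w :+ D) := w :* (:- # 1 :+ # 0)) refl w D)

  closer-difference : ∀ {w D E} → D ≈ w + E → D - E ≈ w * (- 1# + two)
  closer-difference {w} {D} {E} D≈w+E = trans (+-congʳ D≈w+E)
    (solve 2 (λ w E → (w :+ E) :- E := w :* (:- # 1 :+ # 2)) refl w E)

  -- Abstracting over i ≟ j also reduces idMat i j to 1# resp. 0# in the goal.
  L-distance : ∀ i j → ∑ (λ k → L i k * d k j) ≈ τ i - two * idMat i j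
  L-distance i j with i ≟ j
  ... | yes ≡.refl = begin
    ∑ (λ k → L i k * d k i)
      ≈⟨ L-apply i (λ k → d k i) ⟩
    neighbourSum i (λ k → weight i k ⁻¹ * (d i i - d k i))
      ≈⟨ neighbourSum-cong i (λ k e → x≈v*y⇒v⁻¹*x≈y (weight≉0 i k e)
                                        (farther-difference (diagonal-farther e))) ⟩
    neighbourSum i (λ _ → - 1# + 0#)
      ≈⟨ neighbourSum-const i (- 1# + 0#) ⟩
    ι (deg i) * (- 1# + 0#)
      ≈⟨ solve 1 (λ δ → δ :* (:- # 1 :+ # 0) := (# 2 :- δ) :- # 2 :* # 1) refl (ι (deg i)) ⟩
    τ i - two * 1# ∎
  ... | no i≢j = begin
    ∑ (λ k → L i k * d k j)
      ≈⟨ L-apply i (λ k → d k j) ⟩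
    neighbourSum i (λ k → weight i k ⁻¹ * (d i j - d k j))
      ≈⟨ neighbourSum-bump i next-adj _ (λ _ → - 1#) two neighbourTerm ⟩
    neighbourSum i (λ _ → - 1#) + two
      ≈⟨ +-congʳ (neighbourSum-const i (- 1#)) ⟩
    ι (deg i) * - 1# + two
      ≈⟨ solve 1 (λ δ → δ :* (:- # 1) :+ # 2 := (# 2 :- δ) :- # 2 :* # 0) refl (ι (deg i)) ⟩
    τ i - two * 0# ∎
    where
    open Toward (toward i≢j)
    neighbourTerm : ∀ k → adj i k ≡ true →
           weight i k ⁻¹ * (d i j - d k j) ≈ - 1# + (if does (k ≟ next) then two else 0#)
    neighbourTerm k e with k ≟ next
    ... | yes ≡.refl = x≈v*y⇒v⁻¹*x≈y (weight≉0 i k e) (closer-difference next-closer)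
    ... | no k≢next  = x≈v*y⇒v⁻¹*x≈y (weight≉0 i k e) (farther-difference (others-farther k e k≢next))

  farther-squareDifference : ∀ {w D E} → E ≈ w + D → D * D - E * E ≈ w * (- (two * D) - w)
  farther-squareDifference {w} {D} {E} E≈w+D = trans (+-congˡ (-‿cong (*-cong E≈w+D E≈w+D)))
    (solve 2 (λ w D → D :* D :- (w :+ D) :* (w :+ D) := w :* (:- (# 2 :* D) :- w)) refl w D)

  closer-squareDifference : ∀ {w D E} → D ≈ w + E →
                            D * D - E * E ≈ w * ((- (two * D) - w) + four * D)
  closer-squareDifference {w} {D} {E} D≈w+E = begin
    D * D - E * E
      ≈⟨ +-congʳ (*-cong D≈w+E D≈w+E) ⟩
    (w + E) * (w + E) - E * E
      ≈⟨ solve 2 (λ w E → (w :+ E) :* (w :+ E) :- E :* E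
                         := w :* ((:- (# 2 :* (w :+ E)) :- w) :+ # 4 :* (w :+ E))) refl w E ⟩
    w * ((- (two * (w + E)) - w) + four * (w + E))
      ≈⟨ *-congˡ (+-cong (+-congʳ (-‿cong (*-congˡ D≈w+E))) (*-congˡ D≈w+E)) ⟨
    w * ((- (two * D) - w) + four * D) ∎

  neighbourSum-farther : ∀ i D → neighbourSum i (λ k → - (two * D) - weight i k)
                                 ≈ ι (deg i) * - (two * D) - δ̂ i
  neighbourSum-farther i D = begin
    neighbourSum i (λ k → - (two * D) - weight i k)
      ≈⟨ neighbourSum-distrib-+ i (λ _ → - (two * D)) (λ k → - weight i k) ⟩
    neighbourSum i (λ _ → - (two * D)) + neighbourSum i (λ k → - weight i k)
      ≈⟨ +-cong (neighbourSum-const i (- (two * D))) (neighbourSum-neg i (weight i)) ⟩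
    ι (deg i) * - (two * D) - δ̂ i ∎

  L-squaredDistance : ∀ i j → ∑ (λ k → L i k * Δ k j) ≈ two * τ i * d i j - δ̂ i
  L-squaredDistance i j with i ≟ j
  ... | yes ≡.refl = begin
    ∑ (λ k → L i k * Δ k i)
      ≈⟨ L-apply i (λ k → Δ k i) ⟩
    neighbourSum i (λ k → weight i k ⁻¹ * (Δ i i - Δ k i))
      ≈⟨ neighbourSum-cong i (λ k e → x≈v*y⇒v⁻¹*x≈y (weight≉0 i k e)
                                        (farther-squareDifference (diagonal-farther e))) ⟩
    neighbourSum i (λ k → - (two * d i i) - weight i k)
      ≈⟨ neighbourSum-farther i (d i i) ⟩
    ι (deg i) * - (two * d i i) - δ̂ i
      ≈⟨ +-congʳ (*-congˡ (-‿cong (*-congˡ (d-refl i)))) ⟩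
    ι (deg i) * - (two * 0#) - δ̂ i
      ≈⟨ solve 2 (λ δ x → δ :* (:- (# 2 :* # 0)) :- x := # 2 :* (# 2 :- δ) :* # 0 :- x)
                 refl (ι (deg i)) (δ̂ i) ⟩
    two * τ i * 0# - δ̂ i
      ≈⟨ +-congʳ (*-congˡ (d-refl i)) ⟨
    two * τ i * d i i - δ̂ i ∎
  ... | no i≢j = begin
    ∑ (λ k → L i k * Δ k j)
      ≈⟨ L-apply i (λ k → Δ k j) ⟩
    neighbourSum i (λ k → weight i k ⁻¹ * (Δ i j - Δ k j))
      ≈⟨ neighbourSum-bump i next-adj _ (λ k → - (two * d i j) - weight i k) (four * d i j) neighbourTerm ⟩
    neighbourSum i (λ k → - (two * d i j) - weight i k) + four * d i j
      ≈⟨ +-congʳ (neighbourSum-farther i (d i j)) ⟩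
    ι (deg i) * - (two * d i j) - δ̂ i + four * d i j
      ≈⟨ solve 3 (λ δ D x → δ :* (:- (# 2 :* D)) :- x :+ # 4 :* D := # 2 :* (# 2 :- δ) :* D :- x)
                 refl (ι (deg i)) (d i j) (δ̂ i) ⟩
    two * τ i * d i j - δ̂ i ∎
    where
    open Toward (toward i≢j)
    neighbourTerm : ∀ k → adj i k ≡ true →
           weight i k ⁻¹ * (Δ i j - Δ k j)
           ≈ (- (two * d i j) - weight i k) + (if does (k ≟ next) then four * d i j else 0#)
    neighbourTerm k e with k ≟ next
    ... | yes ≡.refl = x≈v*y⇒v⁻¹*x≈y (weight≉0 i k e) (closer-squareDifference next-closer)
    ... | no k≢next  = x≈v*y⇒v⁻¹*x≈y (weight≉0 i k e)
                         (trans (farther-squareDifference (others-farther k e k≢next))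
                                (sym (*-congˡ (+-identityʳ _))))

  τ-Δ≈δ̂-d : ∀ j → ∑ (λ k → τ k * Δ k j) ≈ ∑ (λ k → δ̂ k * d k j)
  τ-Δ≈δ̂-d j = sym (begin
    Y                        ≈⟨ solve 2 (λ X Y → Y := # 2 :* X :- (# 2 :* X :- Y)) refl X Y ⟩
    two * X - (two * X - Y)  ≈⟨ +-congˡ (-‿cong 2X-Y≈X) ⟩
    two * X - X              ≈⟨ solve 1 (λ X → # 2 :* X :- X := X) refl X ⟩
    X                        ∎)
    where
    X Y : Carrier
    X = ∑ (λ k → τ k * Δ k j)
    Y = ∑ (λ k → δ̂ k * d k j)

    [d⊗[L⊗Δ]]jj : (d ⊗ (L ⊗ Δ)) j j ≈ two * X - Y
    [d⊗[L⊗Δ]]jj = begin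
      ∑ (λ k → d j k * (L ⊗ Δ) k j)
        ≈⟨ ∑-cong (λ k → *-cong (d-sym j k) (L-squaredDistance k j)) ⟩
      ∑ (λ k → d k j * (two * τ k * d k j - δ̂ k))
        ≈⟨ ∑-cong (λ k → solve 4 (λ D a t x → D :* (a :* t :* D :- x) := a :* (t :* (D :* D)) :- x :* D)
                                 refl (d k j) two (τ k) (δ̂ k)) ⟩
      ∑ (λ k → two * (τ k * Δ k j) - δ̂ k * d k j)
        ≈⟨ ∑-distrib-- (λ k → two * (τ k * Δ k j)) (λ k → δ̂ k * d k j) ⟩
      ∑ (λ k → two * (τ k * Δ k j)) - Y
        ≈⟨ +-congʳ (*-distribˡ-∑ two (λ k → τ k * Δ k j)) ⟨
      two * X - Y ∎

    [[d⊗L]⊗Δ]jj : ((d ⊗ L) ⊗ Δ) j j ≈ X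
    [[d⊗L]⊗Δ]jj = begin
      ∑ (λ m → (d ⊗ L) j m * Δ m j)
        ≈⟨ ∑-cong (λ m → *-congʳ (trans (⊗-transpose d-sym L-symmetric j m) (L-distance m j))) ⟩
      ∑ (λ m → (τ m - two * idMat m j) * Δ m j)
        ≈⟨ ∑-cong (λ m → solve 4 (λ t a I D → (t :- a :* I) :* D := t :* D :- a :* (D :* I))
                                 refl (τ m) two (idMat m j) (Δ m j)) ⟩
      ∑ (λ m → τ m * Δ m j - two * (Δ m j * idMat m j))
        ≈⟨ ∑-distrib-- (λ m → τ m * Δ m j) (λ m → two * (Δ m j * idMat m j)) ⟩
      X - ∑ (λ m → two * (Δ m j * idMat m j))
        ≈⟨ +-congˡ (-‿cong (*-distribˡ-∑ two (λ m → Δ m j * idMat m j))) ⟨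
      X - two * ((λ a b → Δ b a) ⊗ idMat) j j
        ≈⟨ +-congˡ (-‿cong (*-congˡ (⊗-diagʳ (λ a b → Δ b a) (λ _ → 1#) j j))) ⟩
      X - two * (d j j * d j j * 1#)
        ≈⟨ +-congˡ (-‿cong (*-congˡ (*-congʳ (*-cong (d-refl j) (d-refl j))))) ⟩
      X - two * (0# * 0# * 1#)
        ≈⟨ solve 1 (λ X → X :- # 2 :* (# 0 :* # 0 :* # 1) := X) refl X ⟩
      X ∎

    2X-Y≈X : two * X - Y ≈ X
    2X-Y≈X = trans (sym [d⊗[L⊗Δ]]jj) (trans (sym (⊗-assoc d L Δ j j)) [[d⊗L]⊗Δ]jj)

module SquaredDistanceInverse {c ℓ : Level} (F : Field c ℓ) {n : ℕ} (T : FieldDefs.WTree F n) where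
  open Field F hiding (zero)
  open FieldDefs F
  open TreeDefs T
  open Summation F
  open FieldProperties F
  open MatrixAlgebra F
  open Laplacian F T
  open IntegerCoefficientSolver commutativeRing
  open import Relation.Binary.Reasoning.Setoid setoid

  deg≢2⇒τ≉0 : CharZero → (∀ i → deg i ≢ 2) → ∀ i → ¬ τ i ≈ 0#
  deg≢2⇒τ≉0 char0 deg≢2 i τ≈0 =
    deg≢2 i (≡.sym (ι-injective char0 2 (deg i) (x∙y⁻¹≈ε⇒x≈y two (ι (deg i)) τ≈0)))
    where open import Algebra.Properties.Group +-group using (x∙y⁻¹≈ε⇒x≈y)

  LτL-symmetric : Symmetric ((L ⊗ τ̂) ⊗ L)
  LτL-symmetric i j = ∑-cong (λ m → begin
    (L ⊗ τ̂) i m * L m j     ≈⟨ *-congʳ (⊗-diagʳ L (λ k → τ k ⁻¹) i m) ⟩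
    L i m * τ m ⁻¹ * L m j  ≈⟨ *-cong (*-congʳ (L-symmetric i m)) (L-symmetric m j) ⟩
    L m i * τ m ⁻¹ * L j m  ≈⟨ solve 3 (λ a t b → a :* t :* b := b :* t :* a) refl (L m i) (τ m ⁻¹) (L j m) ⟩
    L j m * τ m ⁻¹ * L m i  ≈⟨ *-congʳ (⊗-diagʳ L (λ k → τ k ⁻¹) j m) ⟨
    (L ⊗ τ̂) j m * L m i     ∎)

  module _ (τ≉0 : ∀ i → ¬ τ i ≈ 0#) where

    [L⊗τ̂]*τ≈L : ∀ i m → (L ⊗ τ̂) i m * τ m ≈ L i m
    [L⊗τ̂]*τ≈L i m = begin
      (L ⊗ τ̂) i m * τ m          ≈⟨ *-congʳ (⊗-diagʳ L (λ k → τ k ⁻¹) i m) ⟩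
      L i m * τ m ⁻¹ * τ m      ≈⟨ *-assoc _ _ _ ⟩
      L i m * (τ m ⁻¹ * τ m)    ≈⟨ *-congˡ (inverseˡ (τ m) (τ≉0 m)) ⟩
      L i m * 1#                ≈⟨ *-identityʳ _ ⟩
      L i m                     ∎

    LτL-Δ : ∀ i j → (((L ⊗ τ̂) ⊗ L) ⊗ Δ) i j ≈ η i - four * idMat i j
    LτL-Δ i j = begin
      (((L ⊗ τ̂) ⊗ L) ⊗ Δ) i j
        ≈⟨ ⊗-assoc (L ⊗ τ̂) L Δ i j ⟩
      ∑ (λ m → (L ⊗ τ̂) i m * (L ⊗ Δ) m j)
        ≈⟨ ∑-cong (λ m → *-congˡ (L-squaredDistance m j)) ⟩
      ∑ (λ m → (L ⊗ τ̂) i m * (two * τ m * d m j - δ̂ m))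
        ≈⟨ ∑-cong summand ⟩
      ∑ (λ m → two * (L i m * d m j) - (L ⊗ τ̂) i m * δ̂ m)
        ≈⟨ ∑-distrib-- (λ m → two * (L i m * d m j)) (λ m → (L ⊗ τ̂) i m * δ̂ m) ⟩
      ∑ (λ m → two * (L i m * d m j)) - ∑ (λ m → (L ⊗ τ̂) i m * δ̂ m)
        ≈⟨ +-congʳ (trans (sym (*-distribˡ-∑ two (λ m → L i m * d m j))) (*-congˡ (L-distance i j))) ⟩
      two * (τ i - two * idMat i j) - ∑ (λ m → (L ⊗ τ̂) i m * δ̂ m)
        ≈⟨ solve 3 (λ t I g → # 2 :* (t :- # 2 :* I) :- g := (# 2 :* t :- g) :- # 4 :* I)
                   refl (τ i) (idMat i j) (∑ (λ m → (L ⊗ τ̂) i m * δ̂ m)) ⟩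
      η i - four * idMat i j ∎
      where
      summand : ∀ m → (L ⊗ τ̂) i m * (two * τ m * d m j - δ̂ m)
                      ≈ two * (L i m * d m j) - (L ⊗ τ̂) i m * δ̂ m
      summand m = begin
        (L ⊗ τ̂) i m * (two * τ m * d m j - δ̂ m)
          ≈⟨ solve 4 (λ q t D x → q :* (# 2 :* t :* D :- x) := # 2 :* (q :* t :* D) :- q :* x)
                     refl ((L ⊗ τ̂) i m) (τ m) (d m j) (δ̂ m) ⟩
        two * ((L ⊗ τ̂) i m * τ m * d m j) - (L ⊗ τ̂) i m * δ̂ m
          ≈⟨ +-congʳ (*-congˡ (*-congʳ ([L⊗τ̂]*τ≈L i m))) ⟩
        two * (L i m * d m j) - (L ⊗ τ̂) i m * δ̂ m ∎

    η-Δ : ∀ j → ∑ (λ k → η k * Δ k j) ≈ β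
    η-Δ j = begin
      ∑ (λ k → η k * Δ k j)
        ≈⟨ ∑-cong (λ k → solve 3 (λ t g D → (# 2 :* t :- g) :* D := # 2 :* (t :* D) :- g :* D)
                                 refl (τ k) (g k) (Δ k j)) ⟩
      ∑ (λ k → two * (τ k * Δ k j) - g k * Δ k j)
        ≈⟨ ∑-distrib-- (λ k → two * (τ k * Δ k j)) (λ k → g k * Δ k j) ⟩
      ∑ (λ k → two * (τ k * Δ k j)) - ∑ (λ k → g k * Δ k j)
        ≈⟨ +-cong (trans (sym (*-distribˡ-∑ two (λ k → τ k * Δ k j))) (*-congˡ (τ-Δ≈δ̂-d j)))
                  (-‿cong g-Δ) ⟩
      two * Y - (two * Y - β′)
        ≈⟨ solve 2 (λ Y b → # 2 :* Y :- (# 2 :* Y :- b) := b) refl Y β′ ⟩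
      β′
        ≈⟨ diag-quadraticForm δ̂ (λ k → τ k ⁻¹) δ̂ ⟨
      β ∎
      where
      g : Vector n
      g k = ∑ (λ m → (L ⊗ τ̂) k m * δ̂ m)

      Y β′ : Carrier
      Y  = ∑ (λ m → δ̂ m * d m j)
      β′ = ∑ (λ m → δ̂ m * (τ m ⁻¹ * δ̂ m))

      τ̂L-Δ : ∀ m → ∑ (λ k → (L ⊗ τ̂) k m * Δ k j) ≈ τ m ⁻¹ * (L ⊗ Δ) m j
      τ̂L-Δ m = begin
        ∑ (λ k → (L ⊗ τ̂) k m * Δ k j)
          ≈⟨ ∑-cong (λ k → *-congʳ (trans (⊗-diagʳ L (λ k → τ k ⁻¹) k m)
                                         (*-congʳ (L-symmetric k m)))) ⟩
        ∑ (λ k → L m k * τ m ⁻¹ * Δ k j)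
          ≈⟨ ∑-cong (λ k → solve 3 (λ a t D → a :* t :* D := t :* (a :* D))
                                   refl (L m k) (τ m ⁻¹) (Δ k j)) ⟩
        ∑ (λ k → τ m ⁻¹ * (L m k * Δ k j))
          ≈⟨ *-distribˡ-∑ (τ m ⁻¹) (λ k → L m k * Δ k j) ⟨
        τ m ⁻¹ * (L ⊗ Δ) m j ∎

      summand : ∀ m → δ̂ m * (τ m ⁻¹ * (two * τ m * d m j - δ̂ m))
                   ≈ two * (δ̂ m * d m j) - δ̂ m * (τ m ⁻¹ * δ̂ m)
      summand m = begin
        δ̂ m * (τ m ⁻¹ * (two * τ m * d m j - δ̂ m))
          ≈⟨ solve 4 (λ x t′ t D → x :* (t′ :* (# 2 :* t :* D :- x))
                                   := # 2 :* (t′ :* t) :* (x :* D) :- x :* (t′ :* x))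
                     refl (δ̂ m) (τ m ⁻¹) (τ m) (d m j) ⟩
        two * (τ m ⁻¹ * τ m) * (δ̂ m * d m j) - δ̂ m * (τ m ⁻¹ * δ̂ m)
          ≈⟨ +-congʳ (*-congʳ (*-congˡ (inverseˡ (τ m) (τ≉0 m)))) ⟩
        two * 1# * (δ̂ m * d m j) - δ̂ m * (τ m ⁻¹ * δ̂ m)
          ≈⟨ solve 2 (λ a b → # 2 :* # 1 :* a :- b := # 2 :* a :- b)
                     refl (δ̂ m * d m j) (δ̂ m * (τ m ⁻¹ * δ̂ m)) ⟩
        two * (δ̂ m * d m j) - δ̂ m * (τ m ⁻¹ * δ̂ m) ∎

      g-Δ : ∑ (λ k → g k * Δ k j) ≈ two * Y - β′
      g-Δ = begin
        ∑ (λ k → g k * Δ k j)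
          ≈⟨ ∑-cong (λ k → *-congʳ (∑-cong (λ m → *-comm ((L ⊗ τ̂) k m) (δ̂ m)))) ⟩
        ∑ (λ k → ∑ (λ m → δ̂ m * (L ⊗ τ̂) k m) * Δ k j)
          ≈⟨ ∑-*-∑-assoc δ̂ (λ m k → (L ⊗ τ̂) k m) (λ k → Δ k j) ⟩
        ∑ (λ m → δ̂ m * ∑ (λ k → (L ⊗ τ̂) k m * Δ k j))
          ≈⟨ ∑-cong (λ m → *-congˡ (trans (τ̂L-Δ m) (*-congˡ (L-squaredDistance m j)))) ⟩
        ∑ (λ m → δ̂ m * (τ m ⁻¹ * (two * τ m * d m j - δ̂ m)))
          ≈⟨ ∑-cong summand ⟩
        ∑ (λ m → two * (δ̂ m * d m j) - δ̂ m * (τ m ⁻¹ * δ̂ m))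
          ≈⟨ ∑-distrib-- (λ m → two * (δ̂ m * d m j)) (λ m → δ̂ m * (τ m ⁻¹ * δ̂ m)) ⟩
        ∑ (λ m → two * (δ̂ m * d m j)) - β′
          ≈⟨ +-congʳ (*-distribˡ-∑ two (λ m → δ̂ m * d m j)) ⟨
        two * Y - β′ ∎

theorem4p4 : ∀ {c ℓ : Level} (F : Field c ℓ) → FieldDefs.CharZero F →
    ∀ (n : ℕ) (T : FieldDefs.WTree F n) →
    (∀ i → FieldDefs.TreeDefs.deg F T i ≢ 2) →
    ¬ (Field._≈_ F (FieldDefs.TreeDefs.β F T) (Field.0# F)) →
    FieldDefs._≈ᴹ_ F (FieldDefs._⊗_ F (FieldDefs.TreeDefs.Δ F T) (FieldDefs.TreeDefs.ΔinvFormula F T)) (FieldDefs.idMat F)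
    × FieldDefs._≈ᴹ_ F (FieldDefs._⊗_ F (FieldDefs.TreeDefs.ΔinvFormula F T) (FieldDefs.TreeDefs.Δ F T)) (FieldDefs.idMat F)
theorem4p4 F char0 n T deg≢2 β≉0 =
  inverse-rightInverse Δ-symmetric LτL-symmetric , inverse-leftInverse
  where
  open Field F using (_≈_; 0#)
  open FieldDefs F
  open TreeDefs T
  open TreeMetric F T using (Δ-symmetric)
  open SquaredDistanceInverse F T

  τ≉0 : ∀ i → ¬ τ i ≈ 0#
  τ≉0 = deg≢2⇒τ≉0 char0 deg≢2

  open MatrixAlgebra.RankOneUpdate F Δ ((L ⊗ τ̂) ⊗ L) η (char0 3) β≉0 (LτL-Δ τ≉0) (η-Δ τ≉0)
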